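{- Let $H$ be an undirected connected planarly embedded graph whose perimeter is a simple polygonal curve, such that all interior vertices have degree at least $6$ and all interior faces are triangles. For a boundary vertex $x\in\partial H$ let $\deg(x)\ge2$ denote its degree. Then $$\sum_{x\in\partial H}\max(4-\deg(x),0)\ge6,$$ the sum being over all boundary vertices. -}

module Defs where

-- Combinatorial model of a connected plane graph: a combinatorial map
-- (rotation system) of genus 0, with a distinguished outer face.

open import Data.Nat using (ℕ; zero; suc; _+_; _*_; _∸_; _≤_)
open import Data.Fin using (Fin; _≟_)
open import Data.List using (List; length; filter; map; allFin)
open import Data.Bool.ListAction using (any)
open import Data.Nat.ListAction using (sum)
open import Data.Bool using (Bool; true; false; if_then_else_; _∧_)
open import Data.Product using (∃-syntax; _×_)
open import Data.Sum using (_⊎_)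
open import Relation.Nullary using (¬_)
open import Relation.Nullary.Decidable using (⌊_⌋)
open import Relation.Binary.PropositionalEquality using (_≡_; _≢_)
open import Relation.Binary.Construct.Closure.ReflexiveTransitive using (Star)

iter : {A : Set} → (A → A) → ℕ → A → A
iter f zero    x = x
iter f (suc k) x = f (iter f k x)

SameOrbit : {n : ℕ} → (Fin n → Fin n) → Fin n → Fin n → Set
SameOrbit f x y = ∃[ k ] iter f k x ≡ y

countLabel : {n m : ℕ} → (Fin n → Fin m) → Fin m → ℕ
countLabel {n} lab x = length (filter (λ d → lab d ≟ x) (allFin n))

record PlaneMap : Set where
  field
    -- darts (half-edges)
    D : ℕ
    -- rotation of darts around their vertex (a permutation)
    σ : Fin D → Fin D
    σ-inj : ∀ {d d'} → σ d ≡ σ d' → d ≡ d'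
    -- the other half of the same edge: fixed-point-free involution
    α : Fin D → Fin D
    α-invol : ∀ d → α (α d) ≡ d
    α-fpf : ∀ d → α d ≢ d
    -- vertices = σ-orbits, given by a labelling onto Fin V
    V : ℕ
    vert : Fin D → Fin V
    vert-orbit₁ : ∀ d d' → vert d ≡ vert d' → SameOrbit σ d d'
    vert-orbit₂ : ∀ d d' → SameOrbit σ d d' → vert d ≡ vert d'
    vert-surj : ∀ x → ∃[ d ] vert d ≡ x
    -- faces = orbits of the face permutation φ = σ ∘ α
    F : ℕ
    face : Fin D → Fin F
    face-orbit₁ : ∀ d d' → face d ≡ face d' → SameOrbit (λ e → σ (α e)) d d'
    face-orbit₂ : ∀ d d' → SameOrbit (λ e → σ (α e)) d d' → face d ≡ face d'
    face-surj : ∀ y → ∃[ d ] face d ≡ y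
    -- edges = α-orbits, so D = 2E
    E : ℕ
    darts-edges : D ≡ 2 * E
    connected : ∀ d d' → Star (λ a b → σ a ≡ b ⊎ α a ≡ b) d d'
    -- genus 0 (planar embedding): Euler's formula V - E + F = 2
    euler : V + F ≡ E + 2
    no-loops : ∀ d → vert (α d) ≢ vert d
    no-multi : ∀ d d' → vert d ≡ vert d' → vert (α d) ≡ vert (α d') → d ≡ d'

module _ (H : PlaneMap) where
  open PlaneMap H

  deg : Fin V → ℕ
  deg = countLabel vert

  faceSize : Fin F → ℕ
  faceSize = countLabel face

  onFace : Fin F → Fin V → Bool
  onFace o x = any (λ d → ⌊ face d ≟ o ⌋ ∧ ⌊ vert d ≟ x ⌋) (allFin D)

  -- the face o is bounded by a simple closed curve (a cycle of length ≥ 3)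
  SimpleCycleFace : Fin F → Set
  SimpleCycleFace o =
    (3 ≤ faceSize o) ×
    (∀ d d' → face d ≡ o → face d' ≡ o → vert d ≡ vert d' → d ≡ d')

  boundaryDefect : Fin F → ℕ
  boundaryDefect o =
    sum (map (λ x → if onFace o x then 4 ∸ deg x else 0) (allFin V))

-- Discrete Gauss–Bonnet.  Counting darts gives Σ deg = D = 2E, and counting
-- them face by face gives D + 3 = 3F + b, where b is the length of the outer
-- cycle, which is also the number of boundary vertices.  Combined with
-- Euler's formula V + F = E + 2 this yields 6V = 6 + D + 2b, that is
--   Σ_{interior x} (6 − deg x) + Σ_{x ∈ ∂H} (4 − deg x) = 6.
-- Interior terms are ≤ 0, and truncating the boundary terms at 0 only
-- increases them, so the boundary defect is at least 6.
module Submission where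

open import Defs
open import Data.Nat using (ℕ; zero; suc; _+_; _*_; _∸_; _≤_)
open import Data.Nat.Properties
  using ( +-*-semiring; +-mono-≤; +-monoʳ-≤; +-cancelʳ-≡; +-cancelˡ-≤; *-identityʳ
        ; ≤-refl; m≤n⇒m≤n+o; m≤n+m∸n; module ≤-Reasoning)
open import Data.Nat.Tactic.RingSolver using (solve; solve-∀)
open import Data.Fin using (Fin; zero; suc; _≟_; punchIn)
open import Data.Fin.Properties using (suc-injective; punchInᵢ≢i)
open import Data.List using ([]; _∷_; length; filter; map; tabulate; allFin)
open import Data.List.Properties using (map-tabulate)
import Data.Nat.ListAction as List
open import Data.Bool using (Bool; true; false; if_then_else_; _∧_)
open import Data.Bool.ListAction using (any)
open import Data.Product using (_×_; _,_)
open import Function using (_∘_; id)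
open import Relation.Nullary using (yes; no; contradiction)
open import Relation.Nullary.Decidable using (⌊_⌋)
open import Relation.Unary using (Pred; Decidable)
open import Relation.Binary.PropositionalEquality
  using (_≡_; _≢_; refl; sym; trans; cong; cong₂; module ≡-Reasoning)
open import Algebra.Properties.Semiring.Sum +-*-semiring
  using (sum-syntax; sum-cong-≗; sum-remove; sum-replicate-zero; ∑-comm; ∑-distrib-+; *-distribˡ-sum)

𝟙 : Bool → ℕ
𝟙 true  = 1
𝟙 false = 0

∑-const : ∀ n c → ∑[ i < n ] c ≡ n * c
∑-const zero    c = refl
∑-const (suc n) c = cong (c +_) (∑-const n c)

∑-mono-≤ : ∀ {n} {f g : Fin n → ℕ} → (∀ i → f i ≤ g i) → ∑[ i < n ] f i ≤ ∑[ i < n ] g i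
∑-mono-≤ {zero}  f≤g = ≤-refl
∑-mono-≤ {suc n} f≤g = +-mono-≤ (f≤g zero) (∑-mono-≤ (f≤g ∘ suc))

sum-tabulate : ∀ {n} (f : Fin n → ℕ) → List.sum (tabulate f) ≡ ∑[ i < n ] f i
sum-tabulate {zero}  f = refl
sum-tabulate {suc n} f = cong (f zero +_) (sum-tabulate (f ∘ suc))

sum-map-allFin : ∀ {n} (f : Fin n → ℕ) → List.sum (map f (allFin n)) ≡ ∑[ i < n ] f i
sum-map-allFin f = trans (cong List.sum (map-tabulate id f)) (sum-tabulate f)

∑-constExcept : ∀ {n} (g : Fin n → ℕ) c o → (∀ i → i ≢ o → g i ≡ c) →
                ∑[ i < n ] g i + c ≡ n * c + g o
∑-constExcept {suc n} g c o g≡c = begin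
  ∑[ i < suc n ] g i + c                  ≡⟨ cong (_+ c) (sum-remove {i = o} g) ⟩
  g o + ∑[ i < n ] g (punchIn o i) + c    ≡⟨ cong (λ s → g o + s + c) rest ⟩
  g o + n * c + c                         ≡⟨ reverse (g o) (n * c) c ⟩
  suc n * c + g o                         ∎
  where
  open ≡-Reasoning
  rest : ∑[ i < n ] g (punchIn o i) ≡ n * c
  rest = trans (sum-cong-≗ (λ i → g≡c (punchIn o i) (punchInᵢ≢i o i))) (∑-const n c)
  reverse : ∀ x y z → x + y + z ≡ z + y + x
  reverse = solve-∀

length-filter-tabulate : ∀ {a p} {A : Set a} {P : Pred A p} (P? : Decidable P) {n} (f : Fin n → A) →
                         length (filter P? (tabulate f)) ≡ ∑[ i < n ] 𝟙 ⌊ P? (f i) ⌋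
length-filter-tabulate P? {zero}  f = refl
length-filter-tabulate P? {suc n} f with P? (f zero)
... | yes _ = cong suc (length-filter-tabulate P? (f ∘ suc))
... | no _  = length-filter-tabulate P? (f ∘ suc)

any-tabulate-unique : ∀ {a} {A : Set a} (p : A → Bool) {n} (f : Fin n → A) →
                      (∀ i j → p (f i) ≡ true → p (f j) ≡ true → i ≡ j) →
                      𝟙 (any p (tabulate f)) ≡ ∑[ i < n ] 𝟙 (p (f i))
any-tabulate-unique p {zero}  f unique = refl
any-tabulate-unique p {suc n} f unique with p (f zero) in p₀
... | true  = cong suc (sym (trans (sum-cong-≗ rest-absent) (sum-replicate-zero n)))
  where
  rest-absent : ∀ i → 𝟙 (p (f (suc i))) ≡ 0
  rest-absent i with p (f (suc i)) in pᵢ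
  ... | true  = contradiction (unique (suc i) zero pᵢ p₀) λ ()
  ... | false = refl
... | false = any-tabulate-unique p (f ∘ suc) λ i j pᵢ pⱼ →
  suc-injective (unique (suc i) (suc j) pᵢ pⱼ)

countLabel-∑ : ∀ {n m} (lab : Fin n → Fin m) x → countLabel lab x ≡ ∑[ d < n ] 𝟙 ⌊ lab d ≟ x ⌋
countLabel-∑ lab x = length-filter-tabulate (λ d → lab d ≟ x) id

∑-𝟙-≟ : ∀ {m} (y : Fin m) → ∑[ x < m ] 𝟙 ⌊ y ≟ x ⌋ ≡ 1
∑-𝟙-≟ {suc m} zero    = cong suc (sum-replicate-zero m)
∑-𝟙-≟ {suc m} (suc y) = trans (sum-cong-≗ (cong 𝟙 ∘ suc≟suc)) (∑-𝟙-≟ y)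
  where
  suc≟suc : ∀ x → ⌊ suc y ≟ suc x ⌋ ≡ ⌊ y ≟ x ⌋
  suc≟suc x with y ≟ x
  ... | yes _ = refl
  ... | no _  = refl

∑-fibres : ∀ {n m} (p : Fin n → Bool) (lab : Fin n → Fin m) →
           ∑[ x < m ] ∑[ d < n ] 𝟙 (p d ∧ ⌊ lab d ≟ x ⌋) ≡ ∑[ d < n ] 𝟙 (p d)
∑-fibres {n} {m} p lab = trans (∑-comm (λ x d → 𝟙 (p d ∧ ⌊ lab d ≟ x ⌋))) (sum-cong-≗ fibre)
  where
  fibre : ∀ d → ∑[ x < m ] 𝟙 (p d ∧ ⌊ lab d ≟ x ⌋) ≡ 𝟙 (p d)
  fibre d with p d
  ... | true  = ∑-𝟙-≟ (lab d)
  ... | false = sum-replicate-zero m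

∑-countLabel : ∀ {n m} (lab : Fin n → Fin m) → ∑[ x < m ] countLabel lab x ≡ n
∑-countLabel {n} lab = begin
  ∑[ x < _ ] countLabel lab x                   ≡⟨ sum-cong-≗ (countLabel-∑ lab) ⟩
  ∑[ x < _ ] ∑[ d < n ] 𝟙 (true ∧ ⌊ lab d ≟ x ⌋) ≡⟨ ∑-fibres (λ _ → true) lab ⟩
  ∑[ d < n ] 1                                  ≡⟨ trans (∑-const n 1) (*-identityʳ n) ⟩
  n                                             ∎
  where open ≡-Reasoning

vertices-from-euler : ∀ {V E F D b} → D ≡ 2 * E → V + F ≡ E + 2 → D + 3 ≡ F * 3 + b →
                      V * 6 ≡ 2 * b + D + 6
vertices-from-euler {V} {E} {F} {b = b} refl euler faces = +-cancelʳ-≡ (2 * (2 * E + 3)) _ _ (begin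
  V * 6 + 2 * (2 * E + 3)              ≡⟨ cong (λ t → V * 6 + 2 * t) faces ⟩
  V * 6 + 2 * (F * 3 + b)              ≡⟨ solve (V ∷ F ∷ b ∷ []) ⟩
  (V + F) * 6 + 2 * b                  ≡⟨ cong (λ t → t * 6 + 2 * b) euler ⟩
  (E + 2) * 6 + 2 * b                  ≡⟨ solve (E ∷ b ∷ []) ⟩
  2 * b + 2 * E + 6 + 2 * (2 * E + 3)  ∎)
  where open ≡-Reasoning

vertexCharge-≥6 : ∀ onBoundary d → (onBoundary ≡ false → 6 ≤ d) →
                  6 ≤ 2 * 𝟙 onBoundary + d + (if onBoundary then 4 ∸ d else 0)
vertexCharge-≥6 true  d _        = +-monoʳ-≤ 2 (m≤n+m∸n 4 d)
vertexCharge-≥6 false d interior = m≤n⇒m≤n+o 0 (interior refl)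

module _ (H : PlaneMap) (o : Fin (PlaneMap.F H)) where
  open PlaneMap H

  ∑-onFace : SimpleCycleFace H o → ∑[ x < V ] 𝟙 (onFace H o x) ≡ faceSize H o
  ∑-onFace (_ , simple) = begin
    ∑[ x < V ] 𝟙 (onFace H o x)
      ≡⟨ sum-cong-≗ onFace-∑ ⟩
    ∑[ x < V ] ∑[ d < D ] 𝟙 (⌊ face d ≟ o ⌋ ∧ ⌊ vert d ≟ x ⌋)
      ≡⟨ ∑-fibres (λ d → ⌊ face d ≟ o ⌋) vert ⟩
    ∑[ d < D ] 𝟙 ⌊ face d ≟ o ⌋
      ≡⟨ countLabel-∑ face o ⟨
    faceSize H o
      ∎
    where
    open ≡-Reasoning
    dart-at : ∀ {d x} → (⌊ face d ≟ o ⌋ ∧ ⌊ vert d ≟ x ⌋) ≡ true → face d ≡ o × vert d ≡ x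
    dart-at {d} {x} _ with face d ≟ o | vert d ≟ x
    dart-at _ | yes d∈o | yes d∈x = d∈o , d∈x
    onFace-∑ : ∀ x → 𝟙 (onFace H o x) ≡ ∑[ d < D ] 𝟙 (⌊ face d ≟ o ⌋ ∧ ⌊ vert d ≟ x ⌋)
    onFace-∑ x = any-tabulate-unique _ id λ d d' at at' →
      let (d∈o , d∈x) = dart-at at ; (d'∈o , d'∈x) = dart-at at' in
      simple d d' d∈o d'∈o (trans d∈x (sym d'∈x))

  darts-by-faces : (∀ f → f ≢ o → faceSize H f ≡ 3) → D + 3 ≡ F * 3 + faceSize H o
  darts-by-faces triangles =
    trans (cong (_+ 3) (sym (∑-countLabel face))) (∑-constExcept (faceSize H) 3 o triangles)

  boundaryTerm : Fin V → ℕ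
  boundaryTerm x = if onFace H o x then 4 ∸ deg H x else 0

  charge : Fin V → ℕ
  charge x = 2 * 𝟙 (onFace H o x) + deg H x + boundaryTerm x

  ∑-charge : SimpleCycleFace H o → ∑[ x < V ] charge x ≡ 2 * faceSize H o + D + boundaryDefect H o
  ∑-charge cycle = begin
    ∑[ x < V ] charge x
      ≡⟨ ∑-distrib-+ (λ x → 2 * 𝟙 (onFace H o x) + deg H x) boundaryTerm ⟩
    ∑[ x < V ] (2 * 𝟙 (onFace H o x) + deg H x) + ∑[ x < V ] boundaryTerm x
      ≡⟨ cong (_+ ∑[ x < V ] boundaryTerm x) (∑-distrib-+ (λ x → 2 * 𝟙 (onFace H o x)) (deg H)) ⟩
    ∑[ x < V ] (2 * 𝟙 (onFace H o x)) + ∑[ x < V ] deg H x + ∑[ x < V ] boundaryTerm x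
      ≡⟨ cong₂ _+_ (cong₂ _+_ (*-distribˡ-sum 2 (λ x → 𝟙 (onFace H o x))) refl) refl ⟨
    2 * ∑[ x < V ] 𝟙 (onFace H o x) + ∑[ x < V ] deg H x + ∑[ x < V ] boundaryTerm x
      ≡⟨ cong₂ _+_ (cong₂ _+_ (cong (2 *_) (∑-onFace cycle)) (∑-countLabel vert))
                   (sym (sum-map-allFin boundaryTerm)) ⟩
    2 * faceSize H o + D + boundaryDefect H o
      ∎
    where open ≡-Reasoning

  charge-≥6 : (∀ x → onFace H o x ≡ false → 6 ≤ deg H x) → ∀ x → 6 ≤ charge x
  charge-≥6 interior x = vertexCharge-≥6 (onFace H o x) (deg H x) (interior x)

lemma8p1 : (H : PlaneMap) → (o : Fin (PlaneMap.F H))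
    → SimpleCycleFace H o
    → (∀ f → f ≢ o → faceSize H f ≡ 3)
    → (∀ x → onFace H o x ≡ false → 6 ≤ deg H x)
    → 6 ≤ boundaryDefect H o
lemma8p1 H o cycle triangles interior = +-cancelˡ-≤ (2 * b + D) 6 (boundaryDefect H o) (begin
  2 * b + D + 6                   ≡⟨ vertices-from-euler {V} {E} {F} darts-edges euler
                                                                      (darts-by-faces H o triangles) ⟨
  V * 6                           ≡⟨ ∑-const V 6 ⟨
  ∑[ x < V ] 6                    ≤⟨ ∑-mono-≤ (charge-≥6 H o interior) ⟩
  ∑[ x < V ] charge H o x         ≡⟨ ∑-charge H o cycle ⟩
  2 * b + D + boundaryDefect H o  ∎)
  where
  open PlaneMap H
  open ≤-Reasoning
  b = faceSize H o
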